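{- Let $s\ge 2$ and let $f_1(x),\ldots,f_s(x)\in\mathbb{Z}[x]$ be nonzero coprime polynomials, with $f_1(x)=a_dx^d+\cdots$ of degree $d$ and leading coefficient $a_d$. For $n\in\mathbb{Z}$ let $d_n=\gcd(f_1(n),\ldots,f_s(n))$, let $m^\ast$ be the lcm of all $d_n$ ($n\in\mathbb{Z}$), and let $T$ be the smallest period of the (periodic) sequence $(d_n)_{n\in\mathbb{Z}}$. Then $T$ divides $m^\ast$ and $m^\ast$ divides $a_d\,T^d\,d!$.
   Context: Polynomials are coprime if their gcd in $\mathbb{Q}[x]$ is $1$ (equivalently, no common complex root). The sequence $(d_n)$ is periodic for coprime polynomials, so a smallest positive period $T$ exists. -}

module Defs where

open import Data.Nat as ℕ using (ℕ; zero; suc; _∸_)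
open import Data.Nat.GCD using (gcd)
open import Data.Nat.Divisibility using (_∣_)
open import Data.Integer as ℤ using (ℤ; ∣_∣)
open import Data.Rational as ℚ using (ℚ; 0ℚ; _/_)
open import Data.Fin using (Fin)
open import Data.List using (List; []; _∷_; map; foldr; upTo)
open import Data.List as List using (tabulate)
open import Data.Product using (Σ; _×_)
open import Relation.Binary.PropositionalEquality using (_≡_; _≢_)

-- Polynomials are represented by coefficient lists, constant term first:
-- a₀ ∷ a₁ ∷ … represents a₀ + a₁ x + … .  Trailing zeros are allowed;
-- all notions below are defined through the coefficient function, so they
-- do not depend on the representative.
ℤPoly : Set
ℤPoly = List ℤ

ℚPoly : Set
ℚPoly = List ℚ

coeffℤ : ℤPoly → ℕ → ℤ
coeffℤ []       _       = ℤ.0ℤ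
coeffℤ (a ∷ _)  zero    = a
coeffℤ (_ ∷ p)  (suc i) = coeffℤ p i

coeffℚ : ℚPoly → ℕ → ℚ
coeffℚ []       _       = 0ℚ
coeffℚ (a ∷ _)  zero    = a
coeffℚ (_ ∷ p)  (suc i) = coeffℚ p i

eval : ℤPoly → ℤ → ℤ
eval []      _ = ℤ.0ℤ
eval (a ∷ p) x = a ℤ.+ x ℤ.* eval p x

NonZeroPoly : ℤPoly → Set
NonZeroPoly f = Σ ℕ (λ i → coeffℤ f i ≢ ℤ.0ℤ)

HasDegree : ℤPoly → ℕ → Set
HasDegree f d = (coeffℤ f d ≢ ℤ.0ℤ) × ((i : ℕ) → d ℕ.< i → coeffℤ f i ≡ ℤ.0ℤ)

toℚPoly : ℤPoly → ℚPoly
toℚPoly = map (λ z → z / 1)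

mulCoeffℚ : ℚPoly → ℚPoly → ℕ → ℚ
mulCoeffℚ p q k = foldr ℚ._+_ 0ℚ (map (λ i → coeffℚ p i ℚ.* coeffℚ q (k ∸ i)) (upTo (suc k)))

_∣ℚ[x]_ : ℚPoly → ℚPoly → Set
p ∣ℚ[x] r = Σ ℚPoly (λ q → (k : ℕ) → mulCoeffℚ p q k ≡ coeffℚ r k)

IsUnitℚ[x] : ℚPoly → Set
IsUnitℚ[x] p = (coeffℚ p 0 ≢ 0ℚ) × ((i : ℕ) → coeffℚ p (suc i) ≡ 0ℚ)

-- f₁,…,f_s are coprime: their gcd in ℚ[x] is 1, i.e. every common divisor
-- in ℚ[x] is a unit
Coprime : {s : ℕ} → (Fin s → ℤPoly) → Set
Coprime {s} f = (g : ℚPoly) → ((i : Fin s) → g ∣ℚ[x] toℚPoly (f i)) → IsUnitℚ[x] g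

-- gcd of a finite family of natural numbers (gcd of empty family = 0)
gcdFin : {s : ℕ} → (Fin s → ℕ) → ℕ
gcdFin {s} v = foldr gcd 0 (tabulate v)

dSeq : {s : ℕ} → (Fin s → ℤPoly) → ℤ → ℕ
dSeq f n = gcdFin (λ i → ∣ eval (f i) n ∣)

IsSmallestPeriod : (ℤ → ℕ) → ℕ → Set
IsSmallestPeriod a T =
  (0 ℕ.< T) × ((n : ℤ) → a (n ℤ.+ ℤ.+ T) ≡ a n) ×
  ((T′ : ℕ) → 0 ℕ.< T′ → ((n : ℤ) → a (n ℤ.+ ℤ.+ T′) ≡ a n) → T ℕ.≤ T′)

IsLcmOfAll : (ℤ → ℕ) → ℕ → Set
IsLcmOfAll a m =
  ((n : ℤ) → a n ∣ m) × ((c : ℕ) → ((n : ℤ) → a n ∣ c) → m ∣ c)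

module Submission where

-- For any integer polynomial, (x − y) ∣ f(x) − f(y); hence
--     dₙ ∣ m* gives dₙ ∣ d_{n+m*} and d_{n+m*} ∣ dₙ, so m* is a period of
--     (dₙ).  Periods are closed under multiples and differences, so
--     m* mod T is a period below T, hence 0.
-- (2) m* ∣ a_d T^d d!.  A polynomial function of degree ≤ d with top
--     coefficient c has d-th forward difference with step t equal to the
--     constant c·∏_{j≤d} (j·t) = c·t^d·d!.  Since T is a period,
--     dₙ = d_{n+jT} ∣ f₁(n + jT) for every j, and d-th differences are
--     integer combinations of such values; so every dₙ divides
--     a_d T^d d!, and therefore so does their lcm m*.

open import Defs
open import Data.Nat using (ℕ; _+_; _^_; _*_; _!)
open import Data.Nat.Divisibility using (_∣_)
open import Data.Integer as ℤ using (ℤ; +_)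
open import Data.Integer.Divisibility as ℤD using ()
open import Data.Fin using (Fin; zero)
open import Data.Product using (_×_)

open import Data.Nat using (zero; suc; z≤n; s≤s; _<_)
import Data.Nat.Properties as NP
import Data.Nat.Divisibility as ND
open import Data.Nat.GCD using (gcd[m,n]∣m; gcd[m,n]∣n; gcd-greatest)
open import Data.Nat.DivMod using (_%_; _/_; m≡m%n+[m/n]*n; m%n<n)
import Data.Nat.Solver as NS
open import Data.Integer.Base using ()
  renaming (∣_∣ to ∣_∣ᶻ; _+_ to _+ᶻ_; _*_ to _*ᶻ_; _-_ to _-ᶻ_; _^_ to _^ᶻ_; 0ℤ to 0ᶻ; 1ℤ to 1ᶻ)
import Data.Integer.Properties as ZP
open import Data.Integer.Divisibility.Signed as S using (divides; ∣ᵤ⇒∣; ∣⇒∣ᵤ)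
open import Data.Integer.Solver using (module +-*-Solver)
open +-*-Solver using (solve; _:+_; _:*_; _:-_; :-_; _:=_; con)
open import Data.Fin using (suc)
open import Data.Product using (_,_; proj₁; proj₂)
open import Data.Empty using (⊥-elim)
open import Data.List using ([]; _∷_)
open import Relation.Binary.PropositionalEquality

module Periods {A : Set} (a : ℤ → A) where

  IsPeriod : ℕ → Set
  IsPeriod p = ∀ n → a (n +ᶻ + p) ≡ a n

  period-* : ∀ {p} → IsPeriod p → ∀ q → IsPeriod (q * p)
  period-* per zero n = cong a (ZP.+-identityʳ n)
  period-* {p} per (suc q) n = begin
    a (n +ᶻ + (p + q * p))     ≡⟨ cong a (cong (n +ᶻ_) (ZP.pos-+ p (q * p))) ⟩
    a (n +ᶻ (+ p +ᶻ + (q * p))) ≡⟨ cong a (solve 3 (λ N A B → N :+ (A :+ B) := N :+ B :+ A)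
                                          refl n (+ p) (+ (q * p))) ⟩
    a (n +ᶻ + (q * p) +ᶻ + p)  ≡⟨ per (n +ᶻ + (q * p)) ⟩
    a (n +ᶻ + (q * p))         ≡⟨ period-* per q n ⟩
    a n                        ∎
    where open ≡-Reasoning

  period-∸ : ∀ p q → IsPeriod q → IsPeriod (p + q) → IsPeriod p
  period-∸ p q perq perpq n = begin
    a (n +ᶻ + p)          ≡⟨ sym (perq (n +ᶻ + p)) ⟩
    a (n +ᶻ + p +ᶻ + q)   ≡⟨ cong a (ZP.+-assoc n (+ p) (+ q)) ⟩
    a (n +ᶻ (+ p +ᶻ + q)) ≡⟨ cong a (cong (n +ᶻ_) (sym (ZP.pos-+ p q))) ⟩
    a (n +ᶻ + (p + q))    ≡⟨ perpq n ⟩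
    a n                   ∎
    where open ≡-Reasoning

smallestPeriod∣period : ∀ (a : ℤ → ℕ) {T p} → IsSmallestPeriod a T →
                        Periods.IsPeriod a p → T ∣ p
smallestPeriod∣period a {suc T′} {p} (_ , perT , minimal) perp =
  remainder-zero (p % T) (m%n<n p T) remainder-period (m≡m%n+[m/n]*n p T)
  where
  open Periods a
  T = suc T′
  remainder-period : IsPeriod (p % T)
  remainder-period = period-∸ (p % T) (p / T * T) (period-* perT (p / T))
                       (subst IsPeriod (m≡m%n+[m/n]*n p T) perp)
  -- a nonzero remainder would be a positive period below T
  remainder-zero : ∀ r → r < T → IsPeriod r → p ≡ r + p / T * T → T ∣ p
  remainder-zero zero _ _ eq = ND.divides (p / T) eq
  remainder-zero (suc r) r<T perr _ = ⊥-elim (NP.<⇒≱ r<T (minimal (suc r) (s≤s z≤n) perr))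

gcdFin∣ : ∀ {s} (v : Fin s → ℕ) i → gcdFin v ∣ v i
gcdFin∣ v zero    = gcd[m,n]∣m (v zero) (gcdFin (λ j → v (suc j)))
gcdFin∣ v (suc i) = ND.∣-trans (gcd[m,n]∣n (v zero) (gcdFin (λ j → v (suc j))))
                               (gcdFin∣ (λ j → v (suc j)) i)

∣gcdFin : ∀ {s} (v : Fin s → ℕ) {x} → (∀ i → x ∣ v i) → x ∣ gcdFin v
∣gcdFin {zero}  v h = _ ND.∣0
∣gcdFin {suc s} v h = gcd-greatest (h zero) (∣gcdFin (λ j → v (suc j)) (λ j → h (suc j)))

eval-sub∣ : ∀ p x y → (x -ᶻ y) S.∣ (eval p x -ᶻ eval p y)
eval-sub∣ []      x y = divides 0ᶻ (sym (ZP.*-zeroˡ (x -ᶻ y)))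
eval-sub∣ (c ∷ p) x y =
  subst ((x -ᶻ y) S.∣_)
    (solve 5 (λ C X Y P Q → X :* (P :- Q) :+ (X :- Y) :* Q := (C :+ X :* P) :- (C :+ Y :* Q))
      refl c x y (eval p x) (eval p y))
    (S.∣m∣n⇒∣m+n (S.∣n⇒∣m*n x (eval-sub∣ p x y)) (S.∣m⇒∣m*n (eval p y) S.∣-refl))

module ValueGcd {s : ℕ} (f : Fin s → ℤPoly) where
  open Periods (dSeq f)

  dSeq∣eval : ∀ n i → + dSeq f n S.∣ eval (f i) n
  dSeq∣eval n i = ∣ᵤ⇒∣ (gcdFin∣ (λ j → ∣ eval (f j) n ∣ᶻ) i)

  -- if d_y ∣ x − y then d_y ∣ d_x, since fᵢ(x) ≡ fᵢ(y) (mod x − y)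
  dSeq∣dSeq : ∀ x y → + dSeq f y S.∣ (x -ᶻ y) → dSeq f y ∣ dSeq f x
  dSeq∣dSeq x y dy∣x-y = ∣gcdFin _ λ i → ∣⇒∣ᵤ
    (subst (+ dSeq f y S.∣_) (solve 2 (λ A B → (A :- B) :+ B := A) refl (eval (f i) x) (eval (f i) y))
      (S.∣m∣n⇒∣m+n (S.∣-trans dy∣x-y (eval-sub∣ (f i) x y)) (dSeq∣eval y i)))

  lcm-period : ∀ m → IsLcmOfAll (dSeq f) m → IsPeriod m
  lcm-period m (all∣m , _) n = ND.∣-antisym
    (dSeq∣dSeq n (n +ᶻ + m)
      (subst (+ dSeq f (n +ᶻ + m) S.∣_) (solve 2 (λ N M → :- M := N :- (N :+ M)) refl n (+ m))
        (S.∣m⇒∣-m (∣ᵤ⇒∣ (all∣m (n +ᶻ + m))))))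
    (dSeq∣dSeq (n +ᶻ + m) n
      (subst (+ dSeq f n S.∣_) (solve 2 (λ N M → M := N :+ M :- N) refl n (+ m)) (∣ᵤ⇒∣ (all∣m n))))

-- Polynomial functions of bounded degree.
-- PolyFn k c g: g : ℤ → ℤ agrees with a polynomial function of degree ≤ k
-- whose xᵏ-coefficient is c.

Fn : Set
Fn = ℤ → ℤ

data PolyFn : ℕ → ℤ → Fn → Set where
  const : ∀ {c g} → (∀ x → g x ≡ c) → PolyFn zero c g
  step : ∀ {k c c′ g} (r : Fn) → PolyFn k c′ r →
           (∀ x → g x ≡ c *ᶻ x ^ᶻ suc k +ᶻ r x) → PolyFn (suc k) c g

polyFn-ext : ∀ k {c g h} → PolyFn k c g → (∀ x → g x ≡ h x) → PolyFn k c h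
polyFn-ext zero    (const p)    g≡h = const λ x → trans (sym (g≡h x)) (p x)
polyFn-ext (suc k) (step r p e) g≡h = step r p λ x → trans (sym (g≡h x)) (e x)

polyFn-coef : ∀ k {c c′ g} → c ≡ c′ → PolyFn k c g → PolyFn k c′ g
polyFn-coef k refl p = p

polyFn-+ : ∀ k {a b g h} → PolyFn k a g → PolyFn k b h → PolyFn k (a +ᶻ b) (λ x → g x +ᶻ h x)
polyFn-+ zero (const p) (const q) = const λ x → cong₂ _+ᶻ_ (p x) (q x)
polyFn-+ (suc k) {a} {b} (step r₁ p₁ e₁) (step r₂ p₂ e₂) =
  step (λ x → r₁ x +ᶻ r₂ x) (polyFn-+ k p₁ p₂) λ x →
    trans (cong₂ _+ᶻ_ (e₁ x) (e₂ x))
      (solve 5 (λ A B X R Q → (A :* X :+ R) :+ (B :* X :+ Q) := (A :+ B) :* X :+ (R :+ Q))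
        refl a b (x ^ᶻ suc k) (r₁ x) (r₂ x))

polyFn-scale : ∀ k (s : ℤ) {c g} → PolyFn k c g → PolyFn k (s *ᶻ c) (λ x → s *ᶻ g x)
polyFn-scale zero    s (const p) = const λ x → cong (s *ᶻ_) (p x)
polyFn-scale (suc k) s {c} (step r p e) =
  step (λ x → s *ᶻ r x) (polyFn-scale k s p) λ x →
    trans (cong (s *ᶻ_) (e x))
      (solve 4 (λ S A X R → S :* (A :* X :+ R) := (S :* A) :* X :+ S :* R) refl s c (x ^ᶻ suc k) (r x))

polyFn-zero : ∀ k → PolyFn k 0ᶻ (λ _ → 0ᶻ)
polyFn-zero zero    = const λ _ → refl
polyFn-zero (suc k) = step (λ _ → 0ᶻ) (polyFn-zero k) λ x → sym (ZP.*-zeroˡ (x ^ᶻ suc k))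

polyFn-lift : ∀ k {c g} → PolyFn k c g → PolyFn (suc k) 0ᶻ g
polyFn-lift k {g = g} p = step g p λ x →
  sym (trans (cong (_+ᶻ g x) (ZP.*-zeroˡ (x ^ᶻ suc k))) (ZP.+-identityˡ (g x)))

polyFn-x* : ∀ k {c h} → PolyFn k c h → PolyFn (suc k) c (λ x → x *ᶻ h x)
polyFn-x* zero {c} (const p) = step (λ _ → 0ᶻ) (polyFn-zero zero) λ x →
  trans (cong (x *ᶻ_) (p x)) (solve 2 (λ X C → X :* C := C :* (X :* con 1ᶻ) :+ con 0ᶻ) refl x c)
polyFn-x* (suc k) {c} (step r p e) = step (λ x → x *ᶻ r x) (polyFn-x* k p) λ x →
  trans (cong (x *ᶻ_) (e x))
    (solve 4 (λ X C P R → X :* (C :* P :+ R) := C :* (X :* P) :+ X :* R) refl x c (x ^ᶻ suc k) (r x))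

polyFn-pow : ∀ k → PolyFn k 1ᶻ (_^ᶻ k)
polyFn-pow zero    = const λ _ → refl
polyFn-pow (suc k) = polyFn-x* k (polyFn-pow k)

eval-vanishing : ∀ p → (∀ i → coeffℤ p i ≡ 0ᶻ) → ∀ x → eval p x ≡ 0ᶻ
eval-vanishing []      _ x = refl
eval-vanishing (c ∷ p) h x =
  trans (cong₂ (λ u v → u +ᶻ x *ᶻ v) (h 0) (eval-vanishing p (λ i → h (suc i)) x))
        (trans (ZP.+-identityˡ _) (ZP.*-zeroʳ x))

polyFn-eval : ∀ p k → (∀ i → k < i → coeffℤ p i ≡ 0ᶻ) → PolyFn k (coeffℤ p k) (eval p)
polyFn-eval []      k _ = polyFn-zero k
polyFn-eval (c ∷ p) zero h = const λ x →
  trans (cong (λ v → c +ᶻ x *ᶻ v) (eval-vanishing p (λ i → h (suc i) (s≤s z≤n)) x))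
        (trans (cong (c +ᶻ_) (ZP.*-zeroʳ x)) (ZP.+-identityʳ c))
polyFn-eval (c ∷ p) (suc k) h =
  polyFn-coef (suc k) (ZP.+-identityˡ (coeffℤ p k))
    (polyFn-+ (suc k) (constant k) (polyFn-x* k (polyFn-eval p k (λ i k<i → h (suc i) (s≤s k<i)))))
  where
  constant : ∀ j → PolyFn (suc j) 0ᶻ (λ _ → c)
  constant zero    = polyFn-lift zero (const λ _ → refl)
  constant (suc j) = polyFn-lift (suc j) (constant j)

module Difference (t : ℤ) where

  Δ : Fn → Fn
  Δ g x = g (x +ᶻ t) -ᶻ g x

  Δ^ : ℕ → Fn → Fn
  Δ^ zero    g = g
  Δ^ (suc k) g = Δ^ k (Δ g)

  -- ∏_{j=1}^{k} j·t, the value of Δᵏ on xᵏ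
  stepFactorial : ℕ → ℤ
  stepFactorial zero    = 1ᶻ
  stepFactorial (suc k) = (+ suc k *ᶻ t) *ᶻ stepFactorial k

  Δ-pow : ∀ k → PolyFn k (+ suc k *ᶻ t) (Δ (_^ᶻ suc k))
  Δ-pow zero = const λ x →
    solve 2 (λ X T → (X :+ T) :* con 1ᶻ :- X :* con 1ᶻ := con 1ᶻ :* T) refl x t
  Δ-pow (suc k) =
    polyFn-ext (suc k)
      (polyFn-coef (suc k) top-coef
        (polyFn-+ (suc k) (polyFn-+ (suc k) (polyFn-x* k (Δ-pow k)) (polyFn-lift k (polyFn-scale k t (Δ-pow k))))
                          (polyFn-scale (suc k) t (polyFn-pow (suc k)))))
      λ x → solve 4 (λ X T A B → X :* (A :- B) :+ T :* (A :- B) :+ T :* B := (X :+ T) :* A :- X :* B)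
              refl x t ((x +ᶻ t) ^ᶻ suc k) (x ^ᶻ suc k)
    where
    top-coef : + suc k *ᶻ t +ᶻ 0ᶻ +ᶻ t *ᶻ 1ᶻ ≡ + suc (suc k) *ᶻ t
    top-coef = trans (solve 2 (λ K T → K :* T :+ con 0ᶻ :+ T :* con 1ᶻ := (con 1ᶻ :+ K) :* T) refl (+ suc k) t)
                     (cong (_*ᶻ t) (sym (ZP.pos-+ 1 (suc k))))

  mutual
    polyFn-Δ : ∀ k {c g} → PolyFn (suc k) c g → PolyFn k (c *ᶻ (+ suc k *ᶻ t)) (Δ g)
    polyFn-Δ k {c} (step r p e) =
      polyFn-ext k
        (polyFn-coef k (ZP.+-identityʳ _) (polyFn-+ k (polyFn-scale k c (Δ-pow k)) (polyFn-Δ-same k p)))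
        λ x → sym (trans (cong₂ _-ᶻ_ (e (x +ᶻ t)) (e x))
          (solve 5 (λ C A B P Q → (C :* A :+ P) :- (C :* B :+ Q) := C :* (A :- B) :+ (P :- Q))
            refl c ((x +ᶻ t) ^ᶻ suc k) (x ^ᶻ suc k) (r (x +ᶻ t)) (r x)))

    polyFn-Δ-same : ∀ k {c g} → PolyFn k c g → PolyFn k 0ᶻ (Δ g)
    polyFn-Δ-same zero {c} (const p) = const λ x → trans (cong₂ _-ᶻ_ (p (x +ᶻ t)) (p x)) (ZP.+-inverseʳ c)
    polyFn-Δ-same (suc k) p = polyFn-lift k (polyFn-Δ k p)

  Δ^-top : ∀ k {c g} → PolyFn k c g → ∀ x → Δ^ k g x ≡ c *ᶻ stepFactorial k
  Δ^-top zero    {c} (const p) x = trans (p x) (sym (ZP.*-identityʳ c))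
  Δ^-top (suc k) {c} p         x =
    trans (Δ^-top k (polyFn-Δ k p) x) (ZP.*-assoc c (+ suc k *ᶻ t) (stepFactorial k))

  Δ^-∣ : ∀ (D n : ℤ) k g → (∀ j → D S.∣ g (n +ᶻ + j *ᶻ t)) → ∀ j → D S.∣ Δ^ k g (n +ᶻ + j *ᶻ t)
  Δ^-∣ D n zero    g h = h
  Δ^-∣ D n (suc k) g h = Δ^-∣ D n k (Δ g) λ j →
    S.∣m∣n⇒∣m-n (subst (λ z → D S.∣ g z) (next j) (h (suc j))) (h j)
    where
    next : ∀ j → n +ᶻ + suc j *ᶻ t ≡ n +ᶻ + j *ᶻ t +ᶻ t
    next j = trans (cong (λ z → n +ᶻ z *ᶻ t) (ZP.pos-+ 1 j))
                   (solve 3 (λ N J T → N :+ (con 1ᶻ :+ J) :* T := N :+ J :* T :+ T) refl n (+ j) t)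

stepFactorial≡ : ∀ T k → Difference.stepFactorial (+ T) k ≡ + (T ^ k * k !)
stepFactorial≡ T zero    = refl
stepFactorial≡ T (suc k) = begin
  (+ suc k *ᶻ + T) *ᶻ stepFactorial (+ T) k ≡⟨ cong₂ _*ᶻ_ (sym (ZP.pos-* (suc k) T)) (stepFactorial≡ T k) ⟩
  + (suc k * T) *ᶻ + (T ^ k * k !)           ≡⟨ sym (ZP.pos-* (suc k * T) (T ^ k * k !)) ⟩
  + (suc k * T * (T ^ k * k !))              ≡⟨ cong +_ (NS.+-*-Solver.solve 4
                                                 (λ K T P Q → (K ℕ* T) ℕ* (P ℕ* Q) ℕ= (T ℕ* P) ℕ* (K ℕ* Q))
                                                 refl (suc k) T (T ^ k) (k !)) ⟩
  + (T ^ suc k * suc k !)                    ∎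
  where
  open ≡-Reasoning
  open Difference using (stepFactorial)
  open NS.+-*-Solver using () renaming (_:*_ to _ℕ*_; _:=_ to _ℕ=_)

module LcmBound {s : ℕ} (f : Fin (suc s) → ℤPoly) where
  open ValueGcd f
  open Periods (dSeq f)

  -- for any period T: dₙ ∣ a_d T^d d!, via Δ_T^d f₁(n) = a_d T^d d!
  dSeq∣top : ∀ d T → HasDegree (f zero) d → IsPeriod T → ∀ n →
             + dSeq f n S.∣ coeffℤ (f zero) d *ᶻ + (T ^ d * d !)
  dSeq∣top d T (_ , above) perT n =
    subst (+ dSeq f n S.∣_) (trans (Δ^-top d (polyFn-eval (f zero) d above) (n +ᶻ + 0 *ᶻ + T))
                                   (cong (coeffℤ (f zero) d *ᶻ_) (stepFactorial≡ T d)))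
      (Δ^-∣ (+ dSeq f n) n d (eval (f zero)) on-progression 0)
    where
    open Difference (+ T)
    -- dₙ = d_{n+jT} ∣ f₁(n + jT)
    on-progression : ∀ j → + dSeq f n S.∣ eval (f zero) (n +ᶻ + j *ᶻ + T)
    on-progression j =
      subst (λ D → + D S.∣ eval (f zero) (n +ᶻ + j *ᶻ + T))
        (trans (cong (λ z → dSeq f (n +ᶻ z)) (sym (ZP.pos-* j T))) (period-* perT j n))
        (dSeq∣eval (n +ᶻ + j *ᶻ + T) zero)

proposition4p3 : (k : ℕ) → (f : Fin (2 + k) → ℤPoly) →
    ((i : Fin (2 + k)) → NonZeroPoly (f i)) → Coprime f →
    (d : ℕ) → HasDegree (f zero) d →
    (T m : ℕ) → IsSmallestPeriod (dSeq f) T → IsLcmOfAll (dSeq f) m →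
    (T ∣ m) × (+ m ℤD.∣ coeffℤ (f zero) d ℤ.* + (T ^ d * d !))
-- Nonvanishing and coprimality guarantee that T and m exist; given them as
-- hypotheses, both divisibilities follow without further use of these facts.
proposition4p3 k f _ _ d deg T m smallest lcm@(_ , lcm-least) =
  T∣m , lcm-least _ (λ n → ∣⇒∣ᵤ (LcmBound.dSeq∣top f d T deg perT n))
  where
  perT : Periods.IsPeriod (dSeq f) T
  perT = proj₁ (proj₂ smallest)
  T∣m : T ∣ m
  T∣m = smallestPeriod∣period (dSeq f) smallest (ValueGcd.lcm-period f m lcm)
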